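{- Let $X$ be a complete lattice and let $O:X^2\to X$ be a quasi-overlap function on $X$. Define $I_O:X^2\to X$ by $I_O(x,y)=\sup\{t\in X \mid O(x,t)\leq y\}$ for all $x,y\in X$. Then $I_O$ is well defined, non-decreasing in the second variable, non-increasing in the first variable, and $I_O(0,0)=I_O(0,1)=I_O(1,1)=1$ and $I_O(1,0)=0$.
   Context: A complete lattice has bottom $0$ and top $1$. A function $O:X^2\to X$ is a quasi-overlap function on the bounded lattice $X$ if: (OL1) $O(x,y)=O(y,x)$; (OL2) $O(x,y)=0$ iff $x=0$ or $y=0$; (OL3) $O(x,y)=1$ iff $x=y=1$; (OL4) $O$ is non-decreasing in each variable. -}

module Defs where

open import Level using (Level; _⊔_; suc; Lift; lift)
open import Data.Empty using (⊥)
open import Data.Unit using (⊤)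
open import Data.Product using (_×_; _,_)
open import Data.Sum using (_⊎_)
open import Function.Bundles using (_⇔_)
open import Relation.Unary using (Pred)
open import Relation.Binary.Bundles using (Poset)

record CompleteLattice (c ℓ₁ ℓ₂ : Level) : Set (suc (c ⊔ ℓ₁ ⊔ ℓ₂)) where
  field
    poset : Poset c ℓ₁ ℓ₂
  open Poset poset public
  field
    ⋁        : Pred Carrier ℓ₂ → Carrier
    ⋁-upper  : (S : Pred Carrier ℓ₂) → ∀ {t} → S t → t ≤ ⋁ S
    ⋁-least  : (S : Pred Carrier ℓ₂) → ∀ {u} → (∀ {t} → S t → t ≤ u) → ⋁ S ≤ u

  𝟘 : Carrier
  𝟘 = ⋁ (λ _ → Lift ℓ₂ ⊥)

  𝟙 : Carrier
  𝟙 = ⋁ (λ _ → Lift ℓ₂ ⊤)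

module _ {c ℓ₁ ℓ₂} (X : CompleteLattice c ℓ₁ ℓ₂) where
  open CompleteLattice X

  record IsQuasiOverlap (O : Carrier → Carrier → Carrier) : Set (c ⊔ ℓ₁ ⊔ ℓ₂) where
    field
      OL1 : ∀ x y → O x y ≈ O y x
      OL2 : ∀ x y → (O x y ≈ 𝟘) ⇔ (x ≈ 𝟘 ⊎ y ≈ 𝟘)
      OL3 : ∀ x y → (O x y ≈ 𝟙) ⇔ (x ≈ 𝟙 × y ≈ 𝟙)
      OL4 : ∀ {x x' y y'} → x ≤ x' → y ≤ y' → O x y ≤ O x' y'

  I[_] : (Carrier → Carrier → Carrier) → Carrier → Carrier → Carrier
  I[ O ] x y = ⋁ (λ t → O x t ≤ y)

-- I_O(x,y) is the supremum of { t | O(x,t) ≤ y }, a set that shrinks as x grows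
-- (O is monotone) and as y shrinks, whence the monotonicity properties. Since
-- O(0,t) = 0, every t qualifies when x = 0 or y = 1, giving I_O = 1; and
-- O(1,t) = 0 forces t = 0 by (OL2), so I_O(1,0) = 0.
module Submission where

open import Defs
open import Data.Product using (_×_; _,_)
open import Data.Sum using (inj₁; inj₂)
open import Level using (Level; lift)
open import Function.Bundles using (Equivalence)
open import Relation.Unary using (Pred; _⊆_)

module CompleteLatticeProperties {c ℓ₁ ℓ₂ : Level} (X : CompleteLattice c ℓ₁ ℓ₂) where
  open CompleteLattice X

  x≤𝟙 : ∀ {x} → x ≤ 𝟙
  x≤𝟙 = ⋁-upper _ (lift _)

  𝟘≤x : ∀ {x} → 𝟘 ≤ x
  𝟘≤x = ⋁-least _ (λ { (lift ()) })

  ⋁-mono : {S T : Pred Carrier ℓ₂} → S ⊆ T → ⋁ S ≤ ⋁ T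
  ⋁-mono S⊆T = ⋁-least _ (λ t∈S → ⋁-upper _ (S⊆T t∈S))

  ⋁-full : {S : Pred Carrier ℓ₂} → (∀ t → S t) → ⋁ S ≈ 𝟙
  ⋁-full full = antisym x≤𝟙 (⋁-least _ (λ _ → ⋁-upper _ (full _)))

  ⋁-⊆𝟘 : {S : Pred Carrier ℓ₂} → (∀ {t} → S t → t ≤ 𝟘) → ⋁ S ≈ 𝟘
  ⋁-⊆𝟘 below = antisym (⋁-least _ below) 𝟘≤x

module ResidualProperties {c ℓ₁ ℓ₂ : Level} (X : CompleteLattice c ℓ₁ ℓ₂)
  {O : CompleteLattice.Carrier X → CompleteLattice.Carrier X → CompleteLattice.Carrier X}
  (O-monoˡ : ∀ {x x' t} → CompleteLattice._≤_ X x x' → CompleteLattice._≤_ X (O x t) (O x' t))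
  where
  open CompleteLattice X
  open CompleteLatticeProperties X

  I-mono : ∀ {x x' y y'} → x' ≤ x → y ≤ y' → I[ X ] O x y ≤ I[ X ] O x' y'
  I-mono x'≤x y≤y' = ⋁-mono (λ Oxt≤y → trans (O-monoˡ x'≤x) (trans Oxt≤y y≤y'))

  I-cong : ∀ {x x' y y'} → x ≈ x' → y ≈ y' → I[ X ] O x y ≈ I[ X ] O x' y'
  I-cong x≈x' y≈y' = antisym
    (I-mono (reflexive (Eq.sym x≈x')) (reflexive y≈y'))
    (I-mono (reflexive x≈x') (reflexive (Eq.sym y≈y')))

module QuasiOverlapResidual {c ℓ₁ ℓ₂ : Level} (X : CompleteLattice c ℓ₁ ℓ₂)
  {O : CompleteLattice.Carrier X → CompleteLattice.Carrier X → CompleteLattice.Carrier X}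
  (isQuasiOverlap : IsQuasiOverlap X O)
  where
  open CompleteLattice X
  open CompleteLatticeProperties X
  open IsQuasiOverlap isQuasiOverlap

  O-monoˡ : ∀ {x x' t} → x ≤ x' → O x t ≤ O x' t
  O-monoˡ x≤x' = OL4 x≤x' refl

  O𝟘t≤𝟘 : ∀ {t} → O 𝟘 t ≤ 𝟘
  O𝟘t≤𝟘 {t} = reflexive (Equivalence.from (OL2 𝟘 t) (inj₁ Eq.refl))

  O𝟙t≤𝟘⇒t≤𝟘 : ∀ {t} → O 𝟙 t ≤ 𝟘 → t ≤ 𝟘
  O𝟙t≤𝟘⇒t≤𝟘 {t} O𝟙t≤𝟘 with Equivalence.to (OL2 𝟙 t) (antisym O𝟙t≤𝟘 𝟘≤x)
  ... | inj₁ 𝟙≈𝟘 = trans x≤𝟙 (reflexive 𝟙≈𝟘)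
  ... | inj₂ t≈𝟘 = reflexive t≈𝟘

lemma3p1 : ∀ {c ℓ₁ ℓ₂} (X : CompleteLattice c ℓ₁ ℓ₂) →
    let open CompleteLattice X in
    (O : Carrier → Carrier → Carrier) → IsQuasiOverlap X O →
    -- well defined (respects the lattice equality)
    (∀ {x x' y y'} → x ≈ x' → y ≈ y' → I[_] X O x y ≈ I[_] X O x' y')
    -- non-decreasing in the second variable
    × (∀ {x y y'} → y ≤ y' → I[_] X O x y ≤ I[_] X O x y')
    -- non-increasing in the first variable
    × (∀ {x x' y} → x ≤ x' → I[_] X O x' y ≤ I[_] X O x y)
    × I[_] X O 𝟘 𝟘 ≈ 𝟙
    × I[_] X O 𝟘 𝟙 ≈ 𝟙
    × I[_] X O 𝟙 𝟙 ≈ 𝟙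
    × I[_] X O 𝟙 𝟘 ≈ 𝟘
lemma3p1 X O isQuasiOverlap =
  I-cong ,
  I-mono refl ,
  (λ x≤x' → I-mono x≤x' refl) ,
  ⋁-full (λ _ → O𝟘t≤𝟘) ,
  ⋁-full (λ _ → x≤𝟙) ,
  ⋁-full (λ _ → x≤𝟙) ,
  ⋁-⊆𝟘 O𝟙t≤𝟘⇒t≤𝟘
  where
  open CompleteLattice X
  open CompleteLatticeProperties X
  open QuasiOverlapResidual X isQuasiOverlap
  open ResidualProperties X O-monoˡ
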